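{- Let $n \in \mathbb{Z}_{\ge 1}$, let $b_n \in \{0,1,2\}$ with $n \equiv b_n \pmod 3$, and let $A \subset \mathbb{Z}_{\ge 1}$ be strongly $n$-bounded, i.e., $A \subset (n/4, n/2)$. Then $A$ works for $n$ if and only if $b_n \notin 3A_{(n)}$, where $A_{(n)} = \{x - \lfloor n/3 \rfloor : x \in A\}$ and $3B = \{x + y + z : x, y, z \in B\}$.
   Context: A numerical semigroup is a subset of $\mathbb{Z}_{\ge 0}$ containing $0$ and closed under addition; $\langle A\rangle$ denotes the numerical semigroup generated by $A$ (all finite non-negative integer combinations of elements of $A$). A set $A \subset \mathbb{Z}_{\ge 1}$ works for $n$ if (i) $n \notin \langle A \rangle$, (ii) $x < n/2$ for all $x \in A$, and (iii) $A$ minimally generates a numerical semigroup, i.e., $\langle A \setminus \{x\}\rangle \neq \langle A \rangle$ for every $x \in A$. In $3B$ the three summands need not be distinct. -}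

module Defs where

open import Data.Nat using (ℕ; zero; suc; _+_; _*_; _<_; _/_; _%_)
open import Data.Integer as ℤ using (ℤ; +_)
open import Data.List using (List; map; filter)
open import Data.List.Membership.Propositional using (_∈_)
open import Data.Product using (Σ; _×_; ∃-syntax)
open import Relation.Binary.PropositionalEquality using (_≡_)
open import Relation.Nullary using (¬_)
open import Relation.Nullary.Decidable using (¬?)
open import Data.Nat using (_≟_)
open import Function.Bundles using (_⇔_)

-- A finite set of positive integers is represented by a list (membership is
-- what matters; order and repetitions are irrelevant).

data ⟨_⟩ (A : List ℕ) : ℕ → Set where
  gen-zero : ⟨ A ⟩ 0
  gen-add  : ∀ {a m} → a ∈ A → ⟨ A ⟩ m → ⟨ A ⟩ (a + m)

remove : ℕ → List ℕ → List ℕ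
remove x = filter (λ y → ¬? (y ≟ x))

MinimallyGenerates : List ℕ → Set
MinimallyGenerates A = ∀ x → x ∈ A → ¬ (∀ m → ⟨ remove x A ⟩ m ⇔ ⟨ A ⟩ m)

Works : ℕ → List ℕ → Set
Works n A = (¬ ⟨ A ⟩ n) × (∀ x → x ∈ A → 2 * x < n) × MinimallyGenerates A

StronglyBounded : ℕ → List ℕ → Set
StronglyBounded n A = ∀ x → x ∈ A → (n < 4 * x) × (2 * x < n)

shiftSet : ℕ → List ℕ → List ℤ
shiftSet n A = map (λ x → + x ℤ.- + (n / 3)) A

InThreeFold : List ℤ → ℤ → Set
InThreeFold B t = ∃[ x ] ∃[ y ] ∃[ z ] (x ∈ B × y ∈ B × z ∈ B × (x ℤ.+ y ℤ.+ z ≡ t))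

b : ℕ → ℕ
b n = n % 3

module Submission where

-- Measure every representation of m in ⟨ A ⟩ by its number of
-- summands.  If all elements of A lie in (n/4, n/2), then a representation
-- with k summands satisfies  k·(n+1) ≤ 4m  and  2m + k ≤ k·n.  Hence
--   * every representation of n has exactly three summands, so
--     n ∈ ⟨ A ⟩  ⇔  n ∈ 3A;
--   * no element x of A is a sum of elements of A \ {x} (such a sum has
--     fewer than two summands, i.e. it is empty or x itself), so A is a
--     minimal generating set.
-- Finally, writing n = b n + 3⌊n/3⌋ and shifting every element by ⌊n/3⌋,
-- n ∈ 3A  ⇔  b n ∈ 3A_(n).  Since the bound 2x < n is part of strong
-- boundedness, "A works for n" reduces to "n ∉ 3A", which gives the theorem.

open import Defs
open import Data.Nat using (ℕ; _≤_)
open import Data.Integer using (+_)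
open import Data.List using (List)
open import Relation.Nullary using (¬_)
open import Function.Bundles using (_⇔_; mk⇔; Equivalence)
open import Function.Base using (_∘_)
open import Function.Properties.Equivalence using () renaming (sym to ⇔-sym; trans to ⇔-trans)

open import Data.Nat using (zero; suc; _+_; _*_; _<_; z≤n; s≤s; _/_; _≟_)
open import Data.Nat.Properties
open import Data.Nat.DivMod using (m≡m%n+[m/n]*n)
open import Data.Nat.Tactic.RingSolver using (solve-∀)
import Data.Integer as ℤ
import Data.Integer.Properties as ℤP
import Data.Integer.Tactic.RingSolver as ℤSolver
open import Data.List using (map)
open import Data.List.Membership.Propositional using (_∈_)
open import Data.List.Membership.Propositional.Properties using (∈-filter⁻; ∈-map⁻; ∈-map⁺)
open import Data.Product using (_×_; _,_; proj₁; proj₂; ∃-syntax)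
open import Relation.Nullary.Decidable using (¬?)
open import Relation.Binary.PropositionalEquality

terms : ∀ {A m} → ⟨ A ⟩ m → ℕ
terms gen-zero        = 0
terms (gen-add _ rep) = suc (terms rep)

terms-positive : ∀ {A m} (rep : ⟨ A ⟩ m) → 0 < m → 0 < terms rep
terms-positive gen-zero        ()
terms-positive (gen-add _ rep) _ = s≤s z≤n

terms-lower-bound : ∀ {A} c L → (∀ a → a ∈ A → L < c * a) →
  ∀ {m} (rep : ⟨ A ⟩ m) → terms rep * suc L ≤ c * m
terms-lower-bound c L bound gen-zero = z≤n
terms-lower-bound c L bound (gen-add {a} {m} a∈A rep) = begin
  suc L + terms rep * suc L  ≤⟨ +-mono-≤ (bound a a∈A) (terms-lower-bound c L bound rep) ⟩
  c * a + c * m              ≡⟨ *-distribˡ-+ c a m ⟨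
  c * (a + m)                ∎
  where open ≤-Reasoning

terms-upper-bound : ∀ {A} c U → (∀ a → a ∈ A → c * a < U) →
  ∀ {m} (rep : ⟨ A ⟩ m) → c * m + terms rep ≤ terms rep * U
terms-upper-bound c U bound gen-zero = ≤-reflexive (trans (+-identityʳ (c * 0)) (*-zeroʳ c))
terms-upper-bound c U bound (gen-add {a} {m} a∈A rep) = begin
  c * (a + m) + suc (terms rep)         ≡⟨ regroup c a m (terms rep) ⟩
  suc (c * a) + (c * m + terms rep)     ≤⟨ +-mono-≤ (bound a a∈A) (terms-upper-bound c U bound rep) ⟩
  U + terms rep * U                     ∎
  where
    open ≤-Reasoning
    regroup : ∀ c a m k → c * (a + m) + suc k ≡ suc (c * a) + (c * m + k)
    regroup = solve-∀

generator : ∀ {A a} → a ∈ A → ⟨ A ⟩ a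
generator {a = a} a∈A = subst ⟨ _ ⟩ (+-identityʳ a) (gen-add a∈A gen-zero)

at-most-one-term : ∀ {A m} (rep : ⟨ A ⟩ m) → terms rep < 2 → 0 < m → m ∈ A
at-most-one-term gen-zero                   _                  ()
at-most-one-term (gen-add {a} a∈A gen-zero) _                  _ = subst (_∈ _) (sym (+-identityʳ a)) a∈A
at-most-one-term (gen-add _ (gen-add _ _))  (s≤s (s≤s ()))     _

InThreeFoldℕ : List ℕ → ℕ → Set
InThreeFoldℕ A m = ∃[ x ] ∃[ y ] ∃[ z ] (x ∈ A × y ∈ A × z ∈ A × (x + y + z ≡ m))

three-summands : ∀ x y z → x + (y + (z + 0)) ≡ x + y + z
three-summands = solve-∀

three-terms : ∀ {A m} (rep : ⟨ A ⟩ m) → terms rep ≡ 3 → InThreeFoldℕ A m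
three-terms (gen-add {x} x∈A (gen-add {y} y∈A (gen-add {z} z∈A gen-zero))) refl =
  x , y , z , x∈A , y∈A , z∈A , sym (three-summands x y z)

three-fold-generated : ∀ {A m} → InThreeFoldℕ A m → ⟨ A ⟩ m
three-fold-generated {A} (x , y , z , x∈A , y∈A , z∈A , refl) =
  subst ⟨ A ⟩ (three-summands x y z) (gen-add x∈A (gen-add y∈A (gen-add z∈A gen-zero)))

∉-remove : ∀ x A → ¬ (x ∈ remove x A)
∉-remove x A x∈ = proj₂ (∈-filter⁻ (λ y → ¬? (y ≟ x)) {xs = A} x∈) refl

remove-⊆ : ∀ {x a} A → a ∈ remove x A → a ∈ A
remove-⊆ {x} A a∈ = proj₁ (∈-filter⁻ (λ y → ¬? (y ≟ x)) {xs = A} a∈)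

-- If no generator is a combination of the others, A generates minimally:
-- x ∈ ⟨ A ⟩ always, so ⟨ A \ {x} ⟩ = ⟨ A ⟩ would put x in ⟨ A \ {x} ⟩.
minimal-if-independent : ∀ A → (∀ x → x ∈ A → ¬ ⟨ remove x A ⟩ x) → MinimallyGenerates A
minimal-if-independent A independent x x∈A same =
  independent x x∈A (Equivalence.from (same x) (generator x∈A))

module StronglyBoundedSet {n : ℕ} {A : List ℕ} (bounded : StronglyBounded n A) where

  above-quarter : ∀ a → a ∈ A → n < 4 * a
  above-quarter a a∈A = proj₁ (bounded a a∈A)

  below-half : ∀ a → a ∈ A → 2 * a < n
  below-half a a∈A = proj₂ (bounded a a∈A)

  positive : ∀ a → a ∈ A → 0 < a
  positive zero    a∈A with () ← above-quarter zero a∈A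
  positive (suc a) _   = s≤s z≤n

  -- For 1 ≤ n, every representation of n in ⟨ A ⟩ has exactly three summands:
  -- k·(n+1) ≤ 4n < 4·(n+1) gives k < 4, and 2n < 2n + k ≤ k·n gives k > 2.
  representations-of-n : 1 ≤ n → (rep : ⟨ A ⟩ n) → terms rep ≡ 3
  representations-of-n 1≤n rep = ≤-antisym (≤-pred below-four) above-two
    where
      k = terms rep
      below-four : k < 4
      below-four = *-cancelʳ-< (suc n) k 4 (begin-strict
        k * suc n  ≤⟨ terms-lower-bound 4 n above-quarter rep ⟩
        4 * n      <⟨ *-monoʳ-< 4 (n<1+n n) ⟩
        4 * suc n  ∎)
        where open ≤-Reasoning
      above-two : 2 < k
      above-two = *-cancelʳ-< n 2 k (begin-strict
        2 * n      <⟨ m<m+n (2 * n) (terms-positive rep 1≤n) ⟩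
        2 * n + k  ≤⟨ terms-upper-bound 2 n below-half rep ⟩
        k * n      ∎)
        where open ≤-Reasoning

  generated⇔three-fold : 1 ≤ n → ⟨ A ⟩ n ⇔ InThreeFoldℕ A n
  generated⇔three-fold 1≤n =
    mk⇔ (λ rep → three-terms rep (representations-of-n 1≤n rep)) three-fold-generated

  -- No x ∈ A is a sum of elements of A \ {x}: such a sum has k summands with
  -- k·(n+1) ≤ 4x < 2n + 2, so k < 2, and since x > 0 this puts x in A \ {x}.
  independent : ∀ x → x ∈ A → ¬ ⟨ remove x A ⟩ x
  independent x x∈A rep =
    ∉-remove x A (at-most-one-term rep fewer-than-two (positive x x∈A))
    where
      fewer-than-two : terms rep < 2
      fewer-than-two = *-cancelʳ-< (suc n) (terms rep) 2 (begin-strict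
        terms rep * suc n  ≤⟨ terms-lower-bound 4 n (λ a a∈ → above-quarter a (remove-⊆ A a∈)) rep ⟩
        4 * x              ≡⟨ *-assoc 2 2 x ⟩
        2 * (2 * x)        <⟨ *-monoʳ-< 2 (below-half x x∈A) ⟩
        2 * n              <⟨ *-monoʳ-< 2 (n<1+n n) ⟩
        2 * suc n          ∎)
        where open ≤-Reasoning

shift-sum : ∀ (X Y Z Q : ℤ.ℤ) → (X ℤ.- Q) ℤ.+ (Y ℤ.- Q) ℤ.+ (Z ℤ.- Q) ≡ (X ℤ.+ Y ℤ.+ Z) ℤ.- Q ℤ.* + 3
shift-sum = ℤSolver.solve-∀

sub-add : ∀ (S T : ℤ.ℤ) → S ℤ.- T ℤ.+ T ≡ S
sub-add = ℤSolver.solve-∀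

add-sub : ∀ (S T : ℤ.ℤ) → S ℤ.+ T ℤ.- T ≡ S
add-sub = ℤSolver.solve-∀

sub-≡⇔ : ∀ (S T R : ℤ.ℤ) → (S ℤ.- T ≡ R) ⇔ (S ≡ R ℤ.+ T)
sub-≡⇔ S T R = mk⇔ (λ eq → trans (sym (sub-add S T)) (cong (ℤ._+ T) eq))
                   (λ eq → trans (cong (ℤ._- T) eq) (add-sub R T))

shifted-sum⇔ : ∀ x y z q r →
  ((+ x ℤ.- + q) ℤ.+ (+ y ℤ.- + q) ℤ.+ (+ z ℤ.- + q) ≡ + r) ⇔ (x + y + z ≡ r + q * 3)
shifted-sum⇔ x y z q r = ⇔-trans (⇔-trans as-difference (sub-≡⇔ (+ (x + y + z)) (+ (q * 3)) (+ r))) embedding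
  where
    sum-embedding : + (x + y + z) ≡ + x ℤ.+ + y ℤ.+ + z
    sum-embedding = trans (ℤP.pos-+ (x + y) z) (cong (ℤ._+ + z) (ℤP.pos-+ x y))

    shifted-as-difference : (+ x ℤ.- + q) ℤ.+ (+ y ℤ.- + q) ℤ.+ (+ z ℤ.- + q) ≡ + (x + y + z) ℤ.- + (q * 3)
    shifted-as-difference = begin
      (+ x ℤ.- + q) ℤ.+ (+ y ℤ.- + q) ℤ.+ (+ z ℤ.- + q)  ≡⟨ shift-sum (+ x) (+ y) (+ z) (+ q) ⟩
      (+ x ℤ.+ + y ℤ.+ + z) ℤ.- + q ℤ.* + 3              ≡⟨ cong₂ ℤ._-_ sum-embedding (ℤP.pos-* q 3) ⟨
      + (x + y + z) ℤ.- + (q * 3)                          ∎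
      where open ≡-Reasoning

    as-difference : ((+ x ℤ.- + q) ℤ.+ (+ y ℤ.- + q) ℤ.+ (+ z ℤ.- + q) ≡ + r) ⇔ (+ (x + y + z) ℤ.- + (q * 3) ≡ + r)
    as-difference = mk⇔ (trans (sym shifted-as-difference)) (trans shifted-as-difference)

    embedding : (+ (x + y + z) ≡ + r ℤ.+ + (q * 3)) ⇔ (x + y + z ≡ r + q * 3)
    embedding = mk⇔ (λ eq → ℤP.+-injective (trans eq (sym (ℤP.pos-+ r (q * 3)))))
                    (λ eq → trans (cong +_ eq) (ℤP.pos-+ r (q * 3)))

three-fold-shift : ∀ q r A →
  InThreeFold (map (λ x → + x ℤ.- + q) A) (+ r) ⇔ InThreeFoldℕ A (r + q * 3)
three-fold-shift q r A = mk⇔ unshift shift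
  where
    shiftBy : ℕ → ℤ.ℤ
    shiftBy x = + x ℤ.- + q

    unshift : InThreeFold (map shiftBy A) (+ r) → InThreeFoldℕ A (r + q * 3)
    unshift (_ , _ , _ , u∈ , v∈ , w∈ , eq) with ∈-map⁻ shiftBy u∈ | ∈-map⁻ shiftBy v∈ | ∈-map⁻ shiftBy w∈
    ... | x , x∈A , refl | y , y∈A , refl | z , z∈A , refl =
      x , y , z , x∈A , y∈A , z∈A , Equivalence.to (shifted-sum⇔ x y z q r) eq

    shift : InThreeFoldℕ A (r + q * 3) → InThreeFold (map shiftBy A) (+ r)
    shift (x , y , z , x∈A , y∈A , z∈A , eq) =
      shiftBy x , shiftBy y , shiftBy z , ∈-map⁺ shiftBy x∈A , ∈-map⁺ shiftBy y∈A , ∈-map⁺ shiftBy z∈A ,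
      Equivalence.from (shifted-sum⇔ x y z q r) eq

proposition8 : (n : ℕ) → 1 ≤ n → (A : List ℕ) → StronglyBounded n A →
    Works n A ⇔ (¬ InThreeFold (shiftSet n A) (+ b n))
proposition8 n 1≤n A bounded =
  mk⇔ (λ (n∉⟨A⟩ , _ , _) → n∉⟨A⟩ ∘ Equivalence.from generated⇔shifted)
      (λ b∉3A → b∉3A ∘ Equivalence.to generated⇔shifted , below-half , minimal-if-independent A independent)
  where
    open StronglyBoundedSet bounded

    n≡b+3q : n ≡ b n + n / 3 * 3
    n≡b+3q = m≡m%n+[m/n]*n n 3

    generated⇔shifted : ⟨ A ⟩ n ⇔ InThreeFold (shiftSet n A) (+ b n)
    generated⇔shifted =
      ⇔-trans (generated⇔three-fold 1≤n)
              (subst (λ m → InThreeFoldℕ A m ⇔ InThreeFold (shiftSet n A) (+ b n)) (sym n≡b+3q) (⇔-sym (three-fold-shift (n / 3) (b n) A)))
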